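{- Let $G$ be a group and $\pi=\{C_1,\dots,C_\ell\}$ a collection of $\ell$ distinct subsets of $G$, each of size $k$ and containing $e$, pairwise intersecting exactly in $\{e\}$ and satisfying the $T$-axiom. Let $AH$ be the automorphism group of the hypergraph $CH(G,\pi)$, with $G$ identified with the subgroup $\{\mathcal{L}_g:g\in G\}$ of $AH$. Then $N_{AH}(G)\cong G\rtimes\mathrm{Aut}(G,\pi)$.
   Context: For $C\subseteq G$ and $g\in G$, $gC=\{gs:s\in C\}$. A collection $\pi$ of subsets of $G$, each containing $e$, satisfies the $T$-axiom if for every $C\in\pi$ and $s\in C$, $s^{ -1}C\in\pi$. The hypergraph $CH(G,\pi)$ has vertex set $G$ and hyperedge set $\{gC:g\in G,C\in\pi\}$; its automorphisms are permutations of $G$ mapping the set of hyperedges bijectively onto itself. $\mathcal{L}_g:G\to G$, $x\mapsto gx$. $N_{AH}(G)$ is the normalizer of $G$ in $AH$. $\mathrm{Aut}(G,\pi)$ is the group of automorphisms $\varphi$ of $G$ such that for each $i$ there is $j$ with $\varphi(C_i)=C_j$. -}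

module Defs where

open import Level using (Level; _⊔_)
open import Algebra.Bundles using (Group)
open import Data.Nat using (ℕ)
open import Data.Fin using (Fin)
open import Data.Product using (Σ; ∃; ∃-syntax; _×_; _,_; proj₁; proj₂)
open import Relation.Binary.PropositionalEquality using (_≡_)
open import Relation.Nullary using (¬_)
open import Function.Bundles using (Inverse)

module _ {a r : Level} (G : Group a r) where
  open Group G

  -- A k-element subset of G, given by an injective enumeration Fin k → G
  -- (injective up to the setoid equality of G).
  Enum : ℕ → Set a
  Enum k = Fin k → Carrier

  IsKSubset : {k : ℕ} → Enum k → Set r
  IsKSubset {k} C = ∀ (m n : Fin k) → C m ≈ C n → m ≡ n

  _∈ₛ_ : {k : ℕ} → Carrier → Enum k → Set r
  x ∈ₛ C = ∃[ m ] (x ≈ C m)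

  _⊆ₛ_ : {k k′ : ℕ} → Enum k → Enum k′ → Set (a ⊔ r)
  C ⊆ₛ D = ∀ x → x ∈ₛ C → x ∈ₛ D

  _≐_ : {k k′ : ℕ} → Enum k → Enum k′ → Set (a ⊔ r)
  C ≐ D = (C ⊆ₛ D) × (D ⊆ₛ C)

  infix 6 _·_
  _·_ : {k : ℕ} → Carrier → Enum k → Enum k
  (g · C) m = g ∙ C m

  img : {k : ℕ} → (Carrier → Carrier) → Enum k → Enum k
  img f C m = f (C m)

  record Hyp {k ℓ : ℕ} (C : Fin ℓ → Enum k) : Set (a ⊔ r) where
    field
      size     : ∀ i → IsKSubset (C i)
      distinct : ∀ i j → ¬ (i ≡ j) → ¬ (C i ≐ C j)
      has-e    : ∀ i → ε ∈ₛ C i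
      trivInt  : ∀ i j → ¬ (i ≡ j) → ∀ x → x ∈ₛ C i → x ∈ₛ C j → x ≈ ε
      T-axiom  : ∀ i s → s ∈ₛ C i → ∃[ j ] (((s ⁻¹) · C i) ≐ C j)

  Perm : Set (a ⊔ r)
  Perm = Inverse setoid setoid

  _≋_ : (Carrier → Carrier) → (Carrier → Carrier) → Set (a ⊔ r)
  f ≋ g = ∀ x → f x ≈ g x

  module _ {k ℓ : ℕ} (C : Fin ℓ → Enum k) where

    IsHyperedge : Enum k → Set (a ⊔ r)
    IsHyperedge D = ∃[ g ] ∃[ i ] (D ≐ (g · C i))

    -- σ ∈ AH = Aut(CH(G,π)): σ is a permutation of G and E ↦ σ(E) is a
    -- bijection of the hyperedge set (σ and σ⁻¹ both map hyperedges to
    -- hyperedges; injectivity is automatic since σ is a bijection).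
    IsHypAut : Perm → Set (a ⊔ r)
    IsHypAut σ =
      (∀ g i → IsHyperedge (img (Inverse.to σ) (g · C i))) ×
      (∀ g i → IsHyperedge (img (Inverse.from σ) (g · C i)))

    Normalizes : Perm → Set (a ⊔ r)
    Normalizes σ =
      (∀ g → ∃[ h ] ((λ x → Inverse.to σ (g ∙ Inverse.from σ x)) ≋ (λ x → h ∙ x))) ×
      (∀ h → ∃[ g ] ((λ x → Inverse.to σ (g ∙ Inverse.from σ x)) ≋ (λ x → h ∙ x)))

    NElt : Set (a ⊔ r)
    NElt = Σ Perm (λ σ → IsHypAut σ × Normalizes σ)

    _≈N_ : NElt → NElt → Set (a ⊔ r)
    σ ≈N τ = Inverse.to (proj₁ σ) ≋ Inverse.to (proj₁ τ)

    IsNProd : NElt → NElt → NElt → Set (a ⊔ r)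
    IsNProd σ τ ρ =
      Inverse.to (proj₁ ρ) ≋ (λ x → Inverse.to (proj₁ σ) (Inverse.to (proj₁ τ) x))

    record GrpAut : Set (a ⊔ r) where
      field
        perm : Perm
        hom  : ∀ x y → Inverse.to perm (x ∙ y) ≈ Inverse.to perm x ∙ Inverse.to perm y

    AutGπ : Set (a ⊔ r)
    AutGπ = Σ GrpAut (λ φ → ∀ i → ∃[ j ] (img (Inverse.to (GrpAut.perm φ)) (C i) ≐ C j))

    aut : AutGπ → Carrier → Carrier
    aut φ = Inverse.to (GrpAut.perm (proj₁ φ))

    SDElt : Set (a ⊔ r)
    SDElt = Carrier × AutGπ

    _≈SD_ : SDElt → SDElt → Set (a ⊔ r)
    (g , φ) ≈SD (h , ψ) = (g ≈ h) × (aut φ ≋ aut ψ)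

    IsSDProd : SDElt → SDElt → SDElt → Set (a ⊔ r)
    IsSDProd (g , φ) (h , ψ) (x , χ) =
      (x ≈ g ∙ aut φ h) × (aut χ ≋ (λ y → aut φ (aut ψ y)))

    record NIsoSD : Set (a ⊔ r) where
      field
        Φ        : NElt → SDElt
        Φ-cong   : ∀ σ τ → σ ≈N τ → Φ σ ≈SD Φ τ
        Φ-inj    : ∀ σ τ → Φ σ ≈SD Φ τ → σ ≈N τ
        Φ-surj   : ∀ y → ∃[ σ ] (Φ σ ≈SD y)
        Φ-hom    : ∀ σ τ ρ → IsNProd σ τ ρ → IsSDProd (Φ σ) (Φ τ) (Φ ρ)

-- An element σ of the normalizer is determined by c = σ(e) and the map φ x = c⁻¹ σ(x):
-- normalizing the left translations forces σ(x y) = σ(x) c⁻¹ σ(y), so φ is an automorphism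
-- and σ = L_c ∘ φ.  φ maps each block C_i, which is the hyperedge e C_i, onto a translate
-- u C_j; as e = φ(e) lies in it, u⁻¹ ∈ C_j and the T-axiom makes u C_j a block.  Conversely
-- L_g ∘ φ is a hypergraph automorphism for φ ∈ Aut(G,π): φ permutes the finitely many
-- distinct blocks injectively, hence bijectively, so φ⁻¹ preserves π as well.
module Submission where

open import Defs
open import Level using (Level; _⊔_)
open import Algebra.Bundles using (Group)
open import Data.Nat using (ℕ; zero; suc)
open import Data.Fin using (Fin; punchOut)

open import Data.Nat.Properties using (n<1+n)
open import Data.Fin.Properties using (_≟_; any?; pigeonhole; punchOut-injective; <-irrefl)
open import Data.Product using (∃-syntax; _,_; proj₁; proj₂)
open import Function.Base using (_∘_)
open import Function.Bundles using (Inverse)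
open import Function.Definitions using (Injective; Congruent)
import Function.Construct.Composition as Composition
open import Relation.Binary.PropositionalEquality as ≡ using (_≡_; _≢_; subst)
open import Relation.Nullary using (¬_)
open import Relation.Nullary.Decidable using (decidable-stable)

Fin-injective⇒surjective : ∀ {n} (f : Fin n → Fin n) → Injective _≡_ _≡_ f →
                           ∀ y → ∃[ x ] f x ≡ y
Fin-injective⇒surjective {zero}  f f-inj ()
Fin-injective⇒surjective {suc n} f f-inj y = decidable-stable (any? λ x → f x ≟ y) hit
  where
  -- If y were missed, punching it out would inject Fin (suc n) into Fin n.
  hit : ¬ ¬ (∃[ x ] f x ≡ y)
  hit miss =
    let y≢f : ∀ x → y ≢ f x
        y≢f x y≡fx = miss (x , ≡.sym y≡fx)
        i , j , i<j , collision = pigeonhole (n<1+n n) (λ x → punchOut (y≢f x))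
    in <-irrefl (f-inj (punchOut-injective (y≢f i) (y≢f j) collision)) i<j

module _ {a r : Level} (G : Group a r) where
  open Group G
  open import Algebra.Properties.Group G
    using (\\-leftDividesˡ; \\-leftDividesʳ; \\-cong₂; y≈x\\z; identityˡ-unique;
           inverseʳ-unique; ⁻¹-involutive)
  open import Algebra.Morphism.Definitions Carrier Carrier _≈_ using (Homomorphic₂)
  open import Relation.Binary.Reasoning.Setoid setoid
  open Inverse using (to; from; to-cong; from-cong; strictlyInverseˡ; strictlyInverseʳ)

  infix 6 _⋆_
  infix 4 _≑_

  _⋆_ : ∀ {k} → Carrier → Enum G k → Enum G k
  _⋆_ = _·_ G

  _≑_ : ∀ {k k′} → Enum G k → Enum G k′ → Set (a ⊔ r)
  _≑_ = _≐_ G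

  ≑-sym : ∀ {k k′} {D : Enum G k} {E : Enum G k′} → D ≑ E → E ≑ D
  ≑-sym (D⊆E , E⊆D) = E⊆D , D⊆E

  ≑-trans : ∀ {k k′ k″} {D : Enum G k} {E : Enum G k′} {F : Enum G k″} →
            D ≑ E → E ≑ F → D ≑ F
  ≑-trans (D⊆E , E⊆D) (E⊆F , F⊆E) = (λ x → E⊆F x ∘ D⊆E x) , (λ x → E⊆D x ∘ F⊆E x)

  pointwise⇒≑ : ∀ {k} {D E : Enum G k} → (∀ m → D m ≈ E m) → D ≑ E
  pointwise⇒≑ D≈E = (λ { x (m , x≈Dm) → m , trans x≈Dm (D≈E m) })
                  , (λ { x (m , x≈Em) → m , trans x≈Em (sym (D≈E m)) })

  img-mono : ∀ {k k′} {f : Carrier → Carrier} → Congruent _≈_ _≈_ f →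
             {D : Enum G k} {E : Enum G k′} → _⊆ₛ_ G D E → _⊆ₛ_ G (img G f D) (img G f E)
  img-mono f-cong {D} D⊆E x (m , x≈fDm) =
    let n , Dm≈En = D⊆E (D m) (m , refl) in n , trans x≈fDm (f-cong Dm≈En)

  img-cong : ∀ {k k′} {f : Carrier → Carrier} → Congruent _≈_ _≈_ f →
             {D : Enum G k} {E : Enum G k′} → D ≑ E → img G f D ≑ img G f E
  img-cong f-cong (D⊆E , E⊆D) = img-mono f-cong D⊆E , img-mono f-cong E⊆D

  img-inverse : ∀ {k} (σ : Perm G) (D : Enum G k) → img G (from σ) (img G (to σ) D) ≑ D
  img-inverse σ D = pointwise⇒≑ (λ m → strictlyInverseʳ σ (D m))

  ⋆-cong : ∀ g {k k′} {D : Enum G k} {E : Enum G k′} → D ≑ E → g ⋆ D ≑ g ⋆ E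
  ⋆-cong g = img-cong {f = g ∙_} ∙-congˡ

  ⋆-assoc : ∀ g h {k} (D : Enum G k) → g ⋆ (h ⋆ D) ≑ (g ∙ h) ⋆ D
  ⋆-assoc g h D = pointwise⇒≑ (λ m → sym (assoc g h (D m)))

  img-homomorphic-⋆ : ∀ {f : Carrier → Carrier} → Homomorphic₂ f _∙_ _∙_ →
                      ∀ g {k} (D : Enum G k) → img G f (g ⋆ D) ≑ f g ⋆ img G f D
  img-homomorphic-⋆ f-hom g D = pointwise⇒≑ (λ m → f-hom g (D m))

  homomorphic⇒ε↦ε : ∀ {f : Carrier → Carrier} → Congruent _≈_ _≈_ f →
                     Homomorphic₂ f _∙_ _∙_ → f ε ≈ ε
  homomorphic⇒ε↦ε {f} f-cong f-hom =
    identityˡ-unique (f ε) (f ε) (trans (sym (f-hom ε ε)) (f-cong (identityˡ ε)))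

  from-homomorphic : (σ : Perm G) → Homomorphic₂ (to σ) _∙_ _∙_ → Homomorphic₂ (from σ) _∙_ _∙_
  from-homomorphic σ σ-hom x y = begin
    from σ (x ∙ y)
      ≈⟨ from-cong σ (∙-cong (strictlyInverseˡ σ x) (strictlyInverseˡ σ y)) ⟨
    from σ (to σ (from σ x) ∙ to σ (from σ y))
      ≈⟨ from-cong σ (σ-hom (from σ x) (from σ y)) ⟨
    from σ (to σ (from σ x ∙ from σ y))
      ≈⟨ strictlyInverseʳ σ _ ⟩
    from σ x ∙ from σ y
      ∎

  translation : Carrier → Perm G
  translation g = record
    { to        = g ∙_
    ; from      = g \\_
    ; to-cong   = ∙-congˡ
    ; from-cong = ∙-congˡ
    ; inverse   = (λ y≈g\\x → trans (∙-congˡ y≈g\\x) (\\-leftDividesˡ g _))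
                , (λ y≈g∙x → trans (∙-congˡ y≈g∙x) (\\-leftDividesʳ g _))
    }

  IsTranslationCovariant : (Carrier → Carrier) → Set (a ⊔ r)
  IsTranslationCovariant s = ∀ g → ∃[ h ] (∀ y → s (g ∙ y) ≈ h ∙ s y)

  autPart : (Carrier → Carrier) → Carrier → Carrier
  autPart s x = s ε \\ s x

  -- Its forward map is autPart (to σ) by definition, as c \\ x unfolds to c ⁻¹ ∙ x.
  autPartPerm : Perm G → Perm G
  autPartPerm σ = Composition.inverse σ (translation (to σ ε ⁻¹))

  -- Comparing the translations s ∘ L_x and L_h ∘ s at e identifies h with s(x) s(e)⁻¹.
  covariant⇒affine : ∀ {s : Carrier → Carrier} → Congruent _≈_ _≈_ s → IsTranslationCovariant s →
                     ∀ x y → s (x ∙ y) ≈ s x ∙ autPart s y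
  covariant⇒affine {s} s-cong covariant x y with covariant x
  ... | h , sx∙≈h∙s = begin
    s (x ∙ y)                 ≈⟨ sx∙≈h∙s y ⟩
    h ∙ s y                   ≈⟨ ∙-congˡ (\\-leftDividesˡ (s ε) (s y)) ⟨
    h ∙ (s ε ∙ autPart s y)   ≈⟨ assoc h (s ε) (autPart s y) ⟨
    (h ∙ s ε) ∙ autPart s y   ≈⟨ ∙-congʳ (trans (s-cong (sym (identityʳ x))) (sx∙≈h∙s ε)) ⟨
    s x ∙ autPart s y         ∎

  autPart-homomorphic : ∀ {s : Carrier → Carrier} → Congruent _≈_ _≈_ s →
                        IsTranslationCovariant s → Homomorphic₂ (autPart s) _∙_ _∙_
  autPart-homomorphic {s} s-cong covariant x y = begin
    s ε ⁻¹ ∙ s (x ∙ y)                ≈⟨ ∙-congˡ (covariant⇒affine s-cong covariant x y) ⟩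
    s ε ⁻¹ ∙ (s x ∙ autPart s y)      ≈⟨ assoc _ _ _ ⟨
    autPart s x ∙ autPart s y         ∎

  autPart-∘ : ∀ {s : Carrier → Carrier} → Congruent _≈_ _≈_ s → IsTranslationCovariant s →
              ∀ (t : Carrier → Carrier) y → autPart (s ∘ t) y ≈ autPart s (autPart t y)
  autPart-∘ {s} s-cong covariant t y = sym (y≈x\\z _ _ _ (begin
    s (t ε) ∙ autPart s (autPart t y) ≈⟨ covariant⇒affine s-cong covariant (t ε) (autPart t y) ⟨
    s (t ε ∙ autPart t y)             ≈⟨ s-cong (\\-leftDividesˡ (t ε) (t y)) ⟩
    s (t y)                           ∎))

  -- σ = L_g ∘ f conjugates L_h to σ ∘ L_h ∘ σ⁻¹ = L_{g f(h) g⁻¹}.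
  affine-conjugation : ∀ (f : Perm G) → Homomorphic₂ (to f) _∙_ _∙_ → ∀ g h x →
                       g ∙ to f (h ∙ from f (g \\ x)) ≈ (g ∙ (to f h ∙ g ⁻¹)) ∙ x
  affine-conjugation f f-hom g h x = begin
    g ∙ to f (h ∙ from f (g \\ x))        ≈⟨ ∙-congˡ (f-hom h _) ⟩
    g ∙ (to f h ∙ to f (from f (g \\ x))) ≈⟨ ∙-congˡ (∙-congˡ (strictlyInverseˡ f _)) ⟩
    g ∙ (to f h ∙ (g ⁻¹ ∙ x))             ≈⟨ ∙-congˡ (assoc _ _ _) ⟨
    g ∙ ((to f h ∙ g ⁻¹) ∙ x)             ≈⟨ assoc _ _ _ ⟨
    (g ∙ (to f h ∙ g ⁻¹)) ∙ x             ∎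

  conjugation-surjective : ∀ (f : Perm G) g h′ → g ∙ (to f (from f (g \\ (h′ ∙ g))) ∙ g ⁻¹) ≈ h′
  conjugation-surjective f g h′ = begin
    g ∙ (to f (from f (g \\ (h′ ∙ g))) ∙ g ⁻¹) ≈⟨ ∙-congˡ (∙-congʳ (strictlyInverseˡ f _)) ⟩
    g ∙ ((g \\ (h′ ∙ g)) ∙ g ⁻¹)               ≈⟨ ∙-congˡ (assoc _ _ _) ⟩
    g ∙ (g \\ ((h′ ∙ g) ∙ g ⁻¹))               ≈⟨ \\-leftDividesˡ g _ ⟩
    (h′ ∙ g) ∙ g ⁻¹                            ≈⟨ assoc _ _ _ ⟩
    h′ ∙ (g ∙ g ⁻¹)                            ≈⟨ ∙-congˡ (inverseʳ g) ⟩
    h′ ∙ ε                                     ≈⟨ identityʳ h′ ⟩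
    h′                                         ∎

  module _ {k ℓ : ℕ} (C : Fin ℓ → Enum G k) where

    Preservesπ : (Carrier → Carrier) → Set (a ⊔ r)
    Preservesπ f = ∀ i → ∃[ j ] (img G f (C i) ≑ C j)

    ≑-hyperedge : ∀ {D E : Enum G k} → D ≑ E → IsHyperedge G C E → IsHyperedge G C D
    ≑-hyperedge D≑E (g , i , E≑gCi) = g , i , ≑-trans D≑E E≑gCi

    ⋆-hyperedge : ∀ g {D : Enum G k} → IsHyperedge G C D → IsHyperedge G C (g ⋆ D)
    ⋆-hyperedge g (h , i , D≑hCi) = g ∙ h , i , ≑-trans (⋆-cong g D≑hCi) (⋆-assoc g h (C i))

    homomorphic-preservesπ⇒hyperedges : ∀ {f : Carrier → Carrier} → Homomorphic₂ f _∙_ _∙_ →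
                                        Preservesπ f → ∀ g i → IsHyperedge G C (img G f (g ⋆ C i))
    homomorphic-preservesπ⇒hyperedges {f} f-hom f-π g i =
      let j , fCi≑Cj = f-π i
      in f g , j , ≑-trans (img-homomorphic-⋆ f-hom g (C i)) (⋆-cong (f g) fCi≑Cj)

    normalizes⇒covariant : (σ : Perm G) → Normalizes G C σ → IsTranslationCovariant (to σ)
    normalizes⇒covariant σ (conjugate , _) g =
      let h , σLσ⁻¹≈Lh = conjugate g
      in h , λ y → trans (to-cong σ (∙-congˡ (sym (strictlyInverseʳ σ y)))) (σLσ⁻¹≈Lh (to σ y))

    affine-normalizes : (f : Perm G) → Homomorphic₂ (to f) _∙_ _∙_ →
                        ∀ g → Normalizes G C (Composition.inverse f (translation g))
    affine-normalizes f f-hom g =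
        (λ h → g ∙ (to f h ∙ g ⁻¹) , affine-conjugation f f-hom g h)
      , (λ h′ → from f (g \\ (h′ ∙ g))
              , λ x → trans (affine-conjugation f f-hom g _ x)
                            (∙-congʳ (conjugation-surjective f g h′)))

    -- As the blocks are distinct, f induces an injection, hence a bijection, of the indices Fin ℓ.
    from-preservesπ : (∀ i j → ¬ i ≡ j → ¬ (C i ≑ C j)) →
                      (f : Perm G) → Preservesπ (to f) → Preservesπ (from f)
    from-preservesπ distinct f f-π i =
      let j , index-j≡i = Fin-injective⇒surjective index index-injective i
          Ci≑fCj = subst (λ i′ → C i′ ≑ img G (to f) (C j)) index-j≡i (≑-sym (proj₂ (f-π j)))
      in j , ≑-trans (img-cong (from-cong f) Ci≑fCj) (img-inverse f (C j))
      where
      index : Fin ℓ → Fin ℓ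
      index i = proj₁ (f-π i)

      index-injective : Injective _≡_ _≡_ index
      index-injective {i} {i′} same-index =
        decidable-stable (i ≟ i′) (λ i≢i′ → distinct i i′ i≢i′ Ci≑Ci′)
        where
        fCi≑fCi′ : img G (to f) (C i) ≑ img G (to f) (C i′)
        fCi≑fCi′ = ≑-trans (proj₂ (f-π i))
                     (subst (λ j → C j ≑ img G (to f) (C i′)) (≡.sym same-index)
                       (≑-sym (proj₂ (f-π i′))))

        Ci≑Ci′ : C i ≑ C i′
        Ci≑Ci′ = ≑-trans (≑-sym (img-inverse f (C i)))
                   (≑-trans (img-cong (from-cong f) fCi≑fCi′) (img-inverse f (C i′)))

    module _ (H : Hyp G C) where
      open Hyp H using (distinct; has-e; T-axiom)

      translate∋ε⇒block : ∀ u j → _∈ₛ_ G ε (u ⋆ C j) → ∃[ j′ ] (u ⋆ C j ≑ C j′)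
      translate∋ε⇒block u j (n , ε≈u∙Cjn) =
        let u⁻¹∈Cj = n , sym (inverseʳ-unique u (C j n) (sym ε≈u∙Cjn))
            j′ , u⁻¹⁻¹Cj≑Cj′ = T-axiom j (u ⁻¹) u⁻¹∈Cj
        in j′ , ≑-trans (pointwise⇒≑ (λ m → ∙-congʳ (sym (⁻¹-involutive u)))) u⁻¹⁻¹Cj≑Cj′

      autPart-preservesπ : (σ : Perm G) → (∀ g i → IsHyperedge G C (img G (to σ) (g ⋆ C i))) →
                           Preservesπ (autPart (to σ))
      autPart-preservesπ σ σ-hyperedges i =
        let h , j , σCi≑hCj = σ-hyperedges ε i
            c = to σ ε
            φCi≑uCj : img G (autPart (to σ)) (C i) ≑ (c ⁻¹ ∙ h) ⋆ C j
            φCi≑uCj = ≑-trans (pointwise⇒≑ (λ m → ∙-congˡ (to-cong σ (sym (identityˡ (C i m))))))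
                        (≑-trans (⋆-cong (c ⁻¹) σCi≑hCj) (⋆-assoc (c ⁻¹) h (C j)))
            m , ε≈Cim = has-e i
            ε∈φCi = m , trans (sym (inverseˡ c)) (∙-congˡ (to-cong σ ε≈Cim))
            j′ , uCj≑Cj′ = translate∋ε⇒block (c ⁻¹ ∙ h) j (proj₁ φCi≑uCj ε ε∈φCi)
        in j′ , ≑-trans φCi≑uCj uCj≑Cj′

      affine-hypAut : (φ : AutGπ G C) → ∀ g →
                      IsHypAut G C (Composition.inverse (GrpAut.perm (proj₁ φ)) (translation g))
      affine-hypAut (φ , φ-π) g =
          (λ h i → ⋆-hyperedge g (homomorphic-preservesπ⇒hyperedges hom φ-π h i))
        , (λ h i → ≑-hyperedge {E = img G (from perm) ((g \\ h) ⋆ C i)}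
                     (pointwise⇒≑ λ m → from-cong perm (sym (assoc (g ⁻¹) h (C i m))))
                     (homomorphic-preservesπ⇒hyperedges (from-homomorphic perm hom)
                       (from-preservesπ distinct perm φ-π) (g \\ h) i))
        where open GrpAut φ

      Φ : NElt G C → SDElt G C
      Φ (σ , σ-hypAut , σ-normalizes) =
        to σ ε , record { perm = autPartPerm σ ; hom = autPart-homomorphic (to-cong σ) covariant }
               , autPart-preservesπ σ (proj₁ σ-hypAut)
        where
        covariant : IsTranslationCovariant (to σ)
        covariant = normalizes⇒covariant σ σ-normalizes

      Φ-cong : ∀ σ τ → _≈N_ G C σ τ → _≈SD_ G C (Φ σ) (Φ τ)
      Φ-cong σ τ σ≈τ = σ≈τ ε , λ x → \\-cong₂ (σ≈τ ε) (σ≈τ x)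

      Φ-injective : ∀ σ τ → _≈SD_ G C (Φ σ) (Φ τ) → _≈N_ G C σ τ
      Φ-injective (σ , _) (τ , _) (σε≈τε , φσ≈φτ) x = begin
        to σ x                      ≈⟨ \\-leftDividesˡ (to σ ε) (to σ x) ⟨
        to σ ε ∙ autPart (to σ) x   ≈⟨ ∙-cong σε≈τε (φσ≈φτ x) ⟩
        to τ ε ∙ autPart (to τ) x   ≈⟨ \\-leftDividesˡ (to τ ε) (to τ x) ⟩
        to τ x                      ∎

      Φ-homomorphic : ∀ σ τ ρ → IsNProd G C σ τ ρ → IsSDProd G C (Φ σ) (Φ τ) (Φ ρ)
      Φ-homomorphic (σ , _ , σ-normalizes) (τ , _) (ρ , _) ρ≈στ =
          trans (ρ≈στ ε) (sym (\\-leftDividesˡ (to σ ε) (to σ (to τ ε))))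
        , λ y → trans (\\-cong₂ (ρ≈στ ε) (ρ≈στ y))
                      (autPart-∘ (to-cong σ) (normalizes⇒covariant σ σ-normalizes) (to τ) y)

      Φ-surjective : ∀ y → ∃[ σ ] (_≈SD_ G C (Φ σ) y)
      Φ-surjective (g , φ) =
          (σ , affine-hypAut φ g , affine-normalizes perm hom g)
        , g∙fε≈g , λ x → trans (\\-cong₂ g∙fε≈g refl) (\\-leftDividesʳ g (to perm x))
        where
        open GrpAut (proj₁ φ)
        σ : Perm G
        σ = Composition.inverse perm (translation g)
        g∙fε≈g : g ∙ to perm ε ≈ g
        g∙fε≈g = trans (∙-congˡ (homomorphic⇒ε↦ε (to-cong perm) hom)) (identityʳ g)

corollary8p4 : {a r : Level} (G : Group a r) (k ℓ : ℕ)
    (C : Fin ℓ → Enum G k) → Hyp G C → NIsoSD G C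
corollary8p4 G k ℓ C H = record
  { Φ      = Φ G C H
  ; Φ-cong = Φ-cong G C H
  ; Φ-inj  = Φ-injective G C H
  ; Φ-surj = Φ-surjective G C H
  ; Φ-hom  = Φ-homomorphic G C H
  }
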